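{- Let $G = (A \cup B, E)$ be a bipartite graph with parts $A$ and $B$, where $|A| \leq |B|$, and let $\delta$ be a positive integer. Suppose that (i) $\deg_G(x) \geq \delta$ for every $x \in A$, and (ii) $e_G(X,Y) < \delta|X|$ for every nonempty $X \subseteq A$ and every $Y \subseteq B$ with $|X| = |Y|$. Then $G$ has a matching which saturates $A$.
   Context: $e_G(X,Y)$ denotes the number of edges of $G$ with one endpoint in $X$ and the other in $Y$. -}

module Defs where

open import Data.Nat using (ℕ; zero; suc; _+_)
open import Data.Bool using (Bool; true; false; _∧_)
open import Data.Fin using (Fin)
import Data.Fin as Fin
open import Data.Fin.Subset using (Subset)
open import Data.Vec using (lookup)
open import Function.Definitions using (Injective)
open import Relation.Binary.PropositionalEquality using (_≡_)
open import Data.Product using (Σ; _×_)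

countFin : ∀ {n} → (Fin n → Bool) → ℕ
countFin {zero}  p = 0
countFin {suc n} p = (if-true (p Fin.zero)) + countFin (λ i → p (Fin.suc i))
  where
  if-true : Bool → ℕ
  if-true true  = 1
  if-true false = 0

sumFin : ∀ {n} → (Fin n → ℕ) → ℕ
sumFin {zero}  f = 0
sumFin {suc n} f = f Fin.zero + sumFin (λ i → f (Fin.suc i))

BipGraph : ℕ → ℕ → Set
BipGraph a b = Fin a → Fin b → Bool

degA : ∀ {a b} → BipGraph a b → Fin a → ℕ
degA G x = countFin (G x)

eG : ∀ {a b} → BipGraph a b → Subset a → Subset b → ℕ
eG {a} {b} G X Y = sumFin {a} (λ x → sel (lookup X x) (countFin (λ y → lookup Y y ∧ G x y)))
  where
  sel : Bool → ℕ → ℕ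
  sel true  k = k
  sel false k = 0

MatchingSaturatingA : ∀ {a b} → BipGraph a b → Set
MatchingSaturatingA {a} {b} G =
  Σ (Fin a → Fin b) λ f → Injective _≡_ _≡_ f × (∀ x → G x (f x) ≡ true)

-- Hall's condition |X| ≤ |N(X)| holds: if some X had fewer than |X| neighbours, enlarge N(X)
-- to a set Y with |Y| = |X| (possible as |X| ≤ |A| ≤ |B|); every edge at X then ends in Y,
-- so e(X,Y) is the degree sum over X, at least δ|X|, contradicting (ii).  Hall's theorem is
-- proved by Rado's edge-deletion argument: if x has two neighbours y₁ ≠ y₂ then deleting xy₁
-- or xy₂ preserves Hall's condition, by submodularity of |N(·)| and modularity of |·|.
module Submission where

open import Defs
open import Data.Nat using (ℕ; _≤_; _<_; _*_; NonZero)
open import Data.Fin.Subset using (Subset; ∣_∣; Nonempty)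
open import Relation.Binary.PropositionalEquality using (_≡_)

open import Data.Nat using (zero; suc; _+_; z≤n; s≤s; s≤s⁻¹; _≤?_)
open import Data.Nat.Properties hiding (_≟_)
open import Data.Nat.Induction using (<-wellFounded)
open import Data.Bool using (Bool; true; false; _∧_)
open import Data.Fin using (Fin; zero; suc; _≟_)
open import Data.Fin.Properties using (all?; ¬∀⟶∃¬)
open import Data.Fin.Subset
  using (inside; outside; _∈_; _∉_; _⊆_; _∪_; _∩_; _-_; ⊥; ⊤; ⁅_⁆)
open import Data.Fin.Subset.Properties
open import Data.Vec using ([]; _∷_; here; there; lookup; tabulate)
open import Data.Vec.Properties using (lookup∘tabulate; []=⇒lookup; lookup⇒[]=)
open import Data.Vec.Functional using (updateAt)
open import Data.Vec.Functional.Properties using (updateAt-updates; updateAt-minimal)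
open import Data.Product using (∃; ∃₂; _×_; _,_; proj₁; proj₂)
import Data.Product as Product
open import Data.Sum using (_⊎_; inj₁; inj₂)
open import Function using (_∘_; id)
open import Function.Definitions using (Injective)
open import Induction.WellFounded using (Acc; acc)
open import Relation.Nullary using (¬_; yes; no; contradiction)
open import Relation.Binary.PropositionalEquality
  using (refl; sym; trans; cong; subst; _≢_; ≢-sym; module ≡-Reasoning)

private
  variable
    k m n : ℕ

∣p∪q∣+∣p∩q∣≡∣p∣+∣q∣ : (p q : Subset n) → ∣ p ∪ q ∣ + ∣ p ∩ q ∣ ≡ ∣ p ∣ + ∣ q ∣
∣p∪q∣+∣p∩q∣≡∣p∣+∣q∣ []            []            = refl
∣p∪q∣+∣p∩q∣≡∣p∣+∣q∣ (inside  ∷ p) (inside  ∷ q) = cong suc (begin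
  ∣ p ∪ q ∣ + suc ∣ p ∩ q ∣  ≡⟨ +-suc _ _ ⟩
  suc (∣ p ∪ q ∣ + ∣ p ∩ q ∣) ≡⟨ cong suc (∣p∪q∣+∣p∩q∣≡∣p∣+∣q∣ p q) ⟩
  suc (∣ p ∣ + ∣ q ∣)         ≡⟨ +-suc _ _ ⟨
  ∣ p ∣ + suc ∣ q ∣           ∎)
  where open ≡-Reasoning
∣p∪q∣+∣p∩q∣≡∣p∣+∣q∣ (inside  ∷ p) (outside ∷ q) = cong suc (∣p∪q∣+∣p∩q∣≡∣p∣+∣q∣ p q)
∣p∪q∣+∣p∩q∣≡∣p∣+∣q∣ (outside ∷ p) (inside  ∷ q) =
  trans (cong suc (∣p∪q∣+∣p∩q∣≡∣p∣+∣q∣ p q)) (sym (+-suc _ _))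
∣p∪q∣+∣p∩q∣≡∣p∣+∣q∣ (outside ∷ p) (outside ∷ q) = ∣p∪q∣+∣p∩q∣≡∣p∣+∣q∣ p q

x∉p-x : ∀ {p : Subset n} (x : Fin n) → x ∉ p - x
x∉p-x {p = _ ∷ _} zero    ()
x∉p-x {p = _ ∷ _} (suc x) (there x∈p-x) = x∉p-x x x∈p-x

x∈p-y⇒x≢y : ∀ {p : Subset n} {x y : Fin n} → x ∈ p - y → x ≢ y
x∈p-y⇒x≢y x∈p-x refl = x∉p-x _ x∈p-x

x∈p⇒∣p∣≡1+∣p-x∣ : ∀ {p : Subset n} {x : Fin n} → x ∈ p → ∣ p ∣ ≡ suc ∣ p - x ∣
x∈p⇒∣p∣≡1+∣p-x∣ {p = inside ∷ p} here = cong (suc ∘ ∣_∣) (sym (p─⊥≡p p))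
x∈p⇒∣p∣≡1+∣p-x∣ {p = inside  ∷ p} (there x∈p) = cong suc (x∈p⇒∣p∣≡1+∣p-x∣ x∈p)
x∈p⇒∣p∣≡1+∣p-x∣ {p = outside ∷ p} (there x∈p) = x∈p⇒∣p∣≡1+∣p-x∣ x∈p

x∈p⇒0<∣p∣ : ∀ {p : Subset n} {x : Fin n} → x ∈ p → 0 < ∣ p ∣
x∈p⇒0<∣p∣ x∈p = ≤-<-trans z≤n (x∈p⇒∣p-x∣<∣p∣ x∈p)

0<∣p∣⇒Nonempty : ∀ {p : Subset n} → 0 < ∣ p ∣ → Nonempty p
0<∣p∣⇒Nonempty {p = inside  ∷ p} _ = zero , here
0<∣p∣⇒Nonempty {p = outside ∷ p} 0<∣p∣ = Product.map suc there (0<∣p∣⇒Nonempty 0<∣p∣)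

x∈p∧y∈p∧x≢y⇒1<∣p∣ : ∀ {p : Subset n} {x y : Fin n} → x ∈ p → y ∈ p → x ≢ y → 1 < ∣ p ∣
x∈p∧y∈p∧x≢y⇒1<∣p∣ x∈p y∈p x≢y = subst (1 <_) (sym (x∈p⇒∣p∣≡1+∣p-x∣ x∈p))
  (s≤s (x∈p⇒0<∣p∣ (x∈p∧x≢y⇒x∈p-y y∈p (≢-sym x≢y))))

∣p∣≤1∧x∈p∧y∈p⇒x≡y : ∀ {p : Subset n} {x y : Fin n} → ∣ p ∣ ≤ 1 → x ∈ p → y ∈ p → x ≡ y
∣p∣≤1∧x∈p∧y∈p⇒x≡y {x = x} {y} ∣p∣≤1 x∈p y∈p with x ≟ y
... | yes x≡y = x≡y
... | no  x≢y = contradiction ∣p∣≤1 (<⇒≱ (x∈p∧y∈p∧x≢y⇒1<∣p∣ x∈p y∈p x≢y))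

1<∣p∣⇒∃-distinct : ∀ {p : Subset n} → 1 < ∣ p ∣ → ∃₂ λ x y → x ∈ p × y ∈ p × x ≢ y
1<∣p∣⇒∃-distinct {p = p} 1<∣p∣ with 0<∣p∣⇒Nonempty {p = p} (<⇒≤ 1<∣p∣)
... | x , x∈p with 0<∣p∣⇒Nonempty {p = p - x} (s≤s⁻¹ (subst (1 <_) (x∈p⇒∣p∣≡1+∣p-x∣ x∈p) 1<∣p∣))
...   | y , y∈p-x = x , y , x∈p , p─q⊆p p ⁅ x ⁆ y∈p-x , ≢-sym (x∈p-y⇒x≢y y∈p-x)

enlarge : (p : Subset n) → ∣ p ∣ ≤ k → k ≤ n → ∃ λ q → p ⊆ q × ∣ q ∣ ≡ k
enlarge []            _          z≤n = [] , id , refl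
enlarge (inside  ∷ p) (s≤s ∣p∣≤k) (s≤s k≤n) =
  Product.map (inside ∷_) (Product.map s⊆s (cong suc)) (enlarge p ∣p∣≤k k≤n)
enlarge {n = suc n} {k} (outside ∷ p) ∣p∣≤k k≤1+n with k ≤? n
... | yes k≤n = Product.map (outside ∷_) (Product.map out⊆ id) (enlarge p ∣p∣≤k k≤n)
... | no  k≰n = ⊤ , ⊆⊤ , trans (∣⊤∣≡n (suc n)) (≤-antisym (≰⇒> k≰n) k≤1+n)

neighbours : (Fin m → Subset n) → Subset m → Subset n
neighbours Γ []            = ⊥
neighbours Γ (inside  ∷ X) = Γ zero ∪ neighbours (Γ ∘ suc) X
neighbours Γ (outside ∷ X) = neighbours (Γ ∘ suc) X

∈-neighbours⁺ : ∀ (Γ : Fin m → Subset n) {X x y} → x ∈ X → y ∈ Γ x → y ∈ neighbours Γ X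
∈-neighbours⁺ Γ {inside  ∷ X} here        y∈Γx = x∈p∪q⁺ (inj₁ y∈Γx)
∈-neighbours⁺ Γ {inside  ∷ X} (there x∈X) y∈Γx = x∈p∪q⁺ (inj₂ (∈-neighbours⁺ (Γ ∘ suc) x∈X y∈Γx))
∈-neighbours⁺ Γ {outside ∷ X} (there x∈X) y∈Γx = ∈-neighbours⁺ (Γ ∘ suc) x∈X y∈Γx

∈-neighbours⁻ : ∀ (Γ : Fin m → Subset n) X {y} → y ∈ neighbours Γ X → ∃ λ x → x ∈ X × y ∈ Γ x
∈-neighbours⁻ Γ [] y∈⊥ = contradiction y∈⊥ ∉⊥
∈-neighbours⁻ Γ (inside ∷ X) y∈N with x∈p∪q⁻ (Γ zero) (neighbours (Γ ∘ suc) X) y∈N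
... | inj₁ y∈Γ0 = zero , here , y∈Γ0
... | inj₂ y∈N′ = Product.map suc (Product.map₁ there) (∈-neighbours⁻ (Γ ∘ suc) X y∈N′)
∈-neighbours⁻ Γ (outside ∷ X) y∈N =
  Product.map suc (Product.map₁ there) (∈-neighbours⁻ (Γ ∘ suc) X y∈N)

neighbours-mono : ∀ (Γ Δ : Fin m → Subset n) {X Y} → X ⊆ Y → (∀ {x} → x ∈ X → Γ x ⊆ Δ x) →
                  neighbours Γ X ⊆ neighbours Δ Y
neighbours-mono Γ Δ {X} X⊆Y Γ⊆Δ y∈N with ∈-neighbours⁻ Γ X y∈N
... | x , x∈X , y∈Γx = ∈-neighbours⁺ Δ (X⊆Y x∈X) (Γ⊆Δ x∈X y∈Γx)

neighbours-⁅x⁆ : ∀ (Γ : Fin m → Subset n) x → neighbours Γ ⁅ x ⁆ ⊆ Γ x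
neighbours-⁅x⁆ Γ x y∈N with ∈-neighbours⁻ Γ ⁅ x ⁆ y∈N
... | z , z∈⁅x⁆ , y∈Γz = subst (λ z → _ ∈ Γ z) (x∈⁅y⁆⇒x≡y x z∈⁅x⁆) y∈Γz

HallCondition : (Fin m → Subset n) → Set
HallCondition Γ = ∀ X → ∣ X ∣ ≤ ∣ neighbours Γ X ∣

Deficient : (Fin m → Subset n) → Subset m → Set
Deficient Γ X = ∣ neighbours Γ X ∣ < ∣ X ∣

hallCondition-or-deficient : (Γ : Fin m → Subset n) → HallCondition Γ ⊎ ∃ (Deficient Γ)
hallCondition-or-deficient Γ with anySubset? (λ X → ∣ neighbours Γ X ∣ <? ∣ X ∣)
... | yes deficient = inj₂ deficient
... | no  ¬deficient = inj₁ (λ X → ≮⇒≥ (¬deficient ∘ (X ,_)))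

Transversal : (Fin m → Subset n) → Set
Transversal {m} {n} Γ = ∃ λ (f : Fin m → Fin n) → Injective _≡_ _≡_ f × (∀ x → f x ∈ Γ x)

delete : (Fin m → Subset n) → Fin m → Fin n → (Fin m → Subset n)
delete Γ x y = updateAt Γ x (_- y)

delete-≢ : ∀ (Γ : Fin m → Subset n) {x z} y → z ≢ x → delete Γ x y z ≡ Γ z
delete-≢ Γ {x} {z} _ z≢x = updateAt-minimal z x Γ z≢x

delete-⊆ : ∀ (Γ : Fin m → Subset n) x y z → delete Γ x y z ⊆ Γ z
delete-⊆ Γ x y z with z ≟ x
... | yes refl = subst (_⊆ Γ x) (sym (updateAt-updates x Γ)) (p─q⊆p (Γ x) ⁅ y ⁆)
... | no  z≢x  = subst (_⊆ Γ z) (sym (delete-≢ Γ y z≢x)) id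

⊆-delete : ∀ (Γ : Fin m → Subset n) {x z} y → z ≢ x → Γ z ⊆ delete Γ x y z
⊆-delete Γ y z≢x = subst (Γ _ ⊆_) (sym (delete-≢ Γ y z≢x)) id

∈-delete⁺ : ∀ (Γ : Fin m → Subset n) {x y z} → z ∈ Γ x → z ≢ y → z ∈ delete Γ x y x
∈-delete⁺ Γ {x} z∈Γx z≢y = subst (_ ∈_) (sym (updateAt-updates x Γ)) (x∈p∧x≢y⇒x∈p-y z∈Γx z≢y)

transversal-delete : ∀ (Γ : Fin m → Subset n) x y → Transversal (delete Γ x y) → Transversal Γ
transversal-delete Γ x y = Product.map₂ (Product.map₂ λ f∈ z → delete-⊆ Γ x y z (f∈ z))

size : (Fin m → Subset n) → ℕ
size Γ = sumFin (∣_∣ ∘ Γ)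

sumFin-mono-≤ : ∀ {f g : Fin n → ℕ} → (∀ i → f i ≤ g i) → sumFin f ≤ sumFin g
sumFin-mono-≤ {zero}  f≤g = z≤n
sumFin-mono-≤ {suc n} f≤g = +-mono-≤ (f≤g zero) (sumFin-mono-≤ (f≤g ∘ suc))

sumFin-mono-< : ∀ {f g : Fin n → ℕ} → (∀ i → f i ≤ g i) → ∀ i → f i < g i → sumFin f < sumFin g
sumFin-mono-< f≤g zero    fi<gi = +-mono-<-≤ fi<gi (sumFin-mono-≤ (f≤g ∘ suc))
sumFin-mono-< f≤g (suc i) fi<gi = +-mono-≤-< (f≤g zero) (sumFin-mono-< (f≤g ∘ suc) i fi<gi)

size-delete : ∀ (Γ : Fin m → Subset n) {x y} → y ∈ Γ x → size (delete Γ x y) < size Γ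
size-delete Γ {x} {y} y∈Γx = sumFin-mono-< (λ z → p⊆q⇒∣p∣≤∣q∣ (delete-⊆ Γ x y z)) x
  (subst (λ p → ∣ p ∣ < ∣ Γ x ∣) (sym (updateAt-updates x Γ)) (x∈p⇒∣p-x∣<∣p∣ y∈Γx))

deficient-delete⇒∈ : ∀ (Γ : Fin m → Subset n) {x y X} →
                     HallCondition Γ → Deficient (delete Γ x y) X → x ∈ X
deficient-delete⇒∈ Γ {x} {y} {X} hall deficient with x ∈? X
... | yes x∈X = x∈X
... | no  x∉X = contradiction (≤-trans (hall X) (p⊆q⇒∣p∣≤∣q∣ N⊆N′)) (<⇒≱ deficient)
  where
  N⊆N′ : neighbours Γ X ⊆ neighbours (delete Γ x y) X
  N⊆N′ = neighbours-mono Γ (delete Γ x y) id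
    (λ z∈X → ⊆-delete Γ y (λ { refl → x∉X z∈X }))

module _ (Γ : Fin m → Subset n) (x : Fin m) (X₁ X₂ : Subset m) {y₁ y₂ : Fin n} where

  private
    N₁ = neighbours (delete Γ x y₁) X₁
    N₂ = neighbours (delete Γ x y₂) X₂

  neighbours-∪-delete : x ∈ X₁ → x ∈ X₂ → y₁ ≢ y₂ → neighbours Γ (X₁ ∪ X₂) ⊆ N₁ ∪ N₂
  neighbours-∪-delete x∈X₁ x∈X₂ y₁≢y₂ {y} y∈N with ∈-neighbours⁻ Γ (X₁ ∪ X₂) y∈N
  ... | z , z∈X₁∪X₂ , y∈Γz with z ≟ x | x∈p∪q⁻ X₁ X₂ z∈X₁∪X₂
  ...   | no z≢x | inj₁ z∈X₁ =
    x∈p∪q⁺ (inj₁ (∈-neighbours⁺ (delete Γ x y₁) z∈X₁ (⊆-delete Γ y₁ z≢x y∈Γz)))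
  ...   | no z≢x | inj₂ z∈X₂ =
    x∈p∪q⁺ (inj₂ (∈-neighbours⁺ (delete Γ x y₂) z∈X₂ (⊆-delete Γ y₂ z≢x y∈Γz)))
  ...   | yes refl | _ with y ≟ y₁
  ...     | no  y≢y₁ = x∈p∪q⁺ (inj₁ (∈-neighbours⁺ (delete Γ x y₁) x∈X₁ (∈-delete⁺ Γ y∈Γz y≢y₁)))
  ...     | yes refl = x∈p∪q⁺ (inj₂ (∈-neighbours⁺ (delete Γ x y₂) x∈X₂ (∈-delete⁺ Γ y∈Γz y₁≢y₂)))

  neighbours-∩-delete : neighbours Γ (X₁ ∩ X₂ - x) ⊆ N₁ ∩ N₂
  neighbours-∩-delete y∈N = x∈p∩q⁺
    ( neighbours-mono Γ (delete Γ x y₁) (p∩q⊆p X₁ X₂ ∘ Z⊆X₁∩X₂) Γ⊆delete y∈N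
    , neighbours-mono Γ (delete Γ x y₂) (p∩q⊆q X₁ X₂ ∘ Z⊆X₁∩X₂) Γ⊆delete y∈N )
    where
    Z⊆X₁∩X₂ = p─q⊆p (X₁ ∩ X₂) ⁅ x ⁆
    Γ⊆delete : ∀ {y z} → z ∈ X₁ ∩ X₂ - x → Γ z ⊆ delete Γ x y z
    Γ⊆delete {y} z∈Z = ⊆-delete Γ y (x∈p-y⇒x≢y z∈Z)

  ¬deficient-both : HallCondition Γ → y₁ ≢ y₂ →
                    ¬ (Deficient (delete Γ x y₁) X₁ × Deficient (delete Γ x y₂) X₂)
  ¬deficient-both hall y₁≢y₂ (def₁ , def₂) = <-irrefl refl (begin-strict
    ∣ X₁ ∣ + ∣ X₂ ∣                        ≡⟨ ∣p∪q∣+∣p∩q∣≡∣p∣+∣q∣ X₁ X₂ ⟨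
    ∣ X₁ ∪ X₂ ∣ + ∣ X₁ ∩ X₂ ∣              ≡⟨ cong (∣ X₁ ∪ X₂ ∣ +_) (x∈p⇒∣p∣≡1+∣p-x∣ x∈X₁∩X₂) ⟩
    ∣ X₁ ∪ X₂ ∣ + suc ∣ X₁ ∩ X₂ - x ∣      ≤⟨ +-mono-≤ (hall (X₁ ∪ X₂)) (s≤s (hall (X₁ ∩ X₂ - x))) ⟩
    ∣ neighbours Γ (X₁ ∪ X₂) ∣ + suc ∣ neighbours Γ (X₁ ∩ X₂ - x) ∣
      ≤⟨ +-mono-≤ (p⊆q⇒∣p∣≤∣q∣ (neighbours-∪-delete x∈X₁ x∈X₂ y₁≢y₂))
                  (s≤s (p⊆q⇒∣p∣≤∣q∣ neighbours-∩-delete)) ⟩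
    ∣ N₁ ∪ N₂ ∣ + suc ∣ N₁ ∩ N₂ ∣          ≡⟨ +-suc _ _ ⟩
    suc (∣ N₁ ∪ N₂ ∣ + ∣ N₁ ∩ N₂ ∣)        ≡⟨ cong suc (∣p∪q∣+∣p∩q∣≡∣p∣+∣q∣ N₁ N₂) ⟩
    suc (∣ N₁ ∣ + ∣ N₂ ∣)                  ≡⟨ +-suc _ _ ⟨
    ∣ N₁ ∣ + suc ∣ N₂ ∣                    <⟨ +-mono-<-≤ def₁ def₂ ⟩
    ∣ X₁ ∣ + ∣ X₂ ∣                        ∎)
    where
    open ≤-Reasoning
    x∈X₁ = deficient-delete⇒∈ Γ hall def₁
    x∈X₂ = deficient-delete⇒∈ Γ hall def₂
    x∈X₁∩X₂ = x∈p∩q⁺ (x∈X₁ , x∈X₂)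

hallCondition-delete : ∀ (Γ : Fin m → Subset n) x {y₁ y₂} → HallCondition Γ → y₁ ≢ y₂ →
                       HallCondition (delete Γ x y₁) ⊎ HallCondition (delete Γ x y₂)
hallCondition-delete Γ x {y₁} {y₂} hall y₁≢y₂
  with hallCondition-or-deficient (delete Γ x y₁) | hallCondition-or-deficient (delete Γ x y₂)
... | inj₁ hall₁        | _                 = inj₁ hall₁
... | inj₂ _            | inj₁ hall₂        = inj₂ hall₂
... | inj₂ (X₁ , def₁) | inj₂ (X₂ , def₂) =
  contradiction (def₁ , def₂) (¬deficient-both Γ x X₁ X₂ hall y₁≢y₂)

hall-∣Γ∣≤1 : ∀ (Γ : Fin m → Subset n) → HallCondition Γ → (∀ x → ∣ Γ x ∣ ≤ 1) → Transversal Γ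
hall-∣Γ∣≤1 Γ hall ∣Γ∣≤1 = f , f-injective , f∈Γ
  where
  nonempty : ∀ x → Nonempty (Γ x)
  nonempty x = 0<∣p∣⇒Nonempty (begin
    1                           ≡⟨ ∣⁅x⁆∣≡1 x ⟨
    ∣ ⁅ x ⁆ ∣                   ≤⟨ hall ⁅ x ⁆ ⟩
    ∣ neighbours Γ ⁅ x ⁆ ∣      ≤⟨ p⊆q⇒∣p∣≤∣q∣ (neighbours-⁅x⁆ Γ x) ⟩
    ∣ Γ x ∣                     ∎)
    where open ≤-Reasoning
  f = proj₁ ∘ nonempty
  f∈Γ = proj₂ ∘ nonempty

  Γ⊆⁅f⁆ : ∀ x → Γ x ⊆ ⁅ f x ⁆
  Γ⊆⁅f⁆ x y∈Γx = subst (_∈ ⁅ f x ⁆) (∣p∣≤1∧x∈p∧y∈p⇒x≡y (∣Γ∣≤1 x) (f∈Γ x) y∈Γx) (x∈⁅x⁆ (f x))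

  f-injective : Injective _≡_ _≡_ f
  f-injective {x} {x′} fx≡fx′ with x ≟ x′
  ... | yes x≡x′ = x≡x′
  ... | no  x≢x′ = contradiction (hall X) (<⇒≱ (begin-strict
    ∣ neighbours Γ X ∣  ≤⟨ p⊆q⇒∣p∣≤∣q∣ N⊆⁅fx⁆ ⟩
    ∣ ⁅ f x ⁆ ∣         ≡⟨ ∣⁅x⁆∣≡1 (f x) ⟩
    1                   <⟨ x∈p∧y∈p∧x≢y⇒1<∣p∣ x∈X x′∈X x≢x′ ⟩
    ∣ X ∣               ∎))
    where
    open ≤-Reasoning
    X = ⁅ x ⁆ ∪ ⁅ x′ ⁆
    x∈X = x∈p∪q⁺ (inj₁ (x∈⁅x⁆ x))
    x′∈X = x∈p∪q⁺ (inj₂ (x∈⁅x⁆ x′))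
    fz≡fx : ∀ {z} → z ∈ X → f z ≡ f x
    fz≡fx z∈X with x∈p∪q⁻ ⁅ x ⁆ ⁅ x′ ⁆ z∈X
    ... | inj₁ z∈⁅x⁆  = cong f (x∈⁅y⁆⇒x≡y x z∈⁅x⁆)
    ... | inj₂ z∈⁅x′⁆ = trans (cong f (x∈⁅y⁆⇒x≡y x′ z∈⁅x′⁆)) (sym fx≡fx′)
    N⊆⁅fx⁆ : neighbours Γ X ⊆ ⁅ f x ⁆
    N⊆⁅fx⁆ y∈N with ∈-neighbours⁻ Γ X y∈N
    ... | z , z∈X , y∈Γz = subst (λ w → _ ∈ ⁅ w ⁆) (fz≡fx z∈X) (Γ⊆⁅f⁆ z y∈Γz)

hall : ∀ (Γ : Fin m → Subset n) → HallCondition Γ → Transversal Γ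
hall Γ hallΓ = hall-acc Γ hallΓ (<-wellFounded (size Γ))
  where
  hall-acc : ∀ (Γ : Fin m → Subset n) → HallCondition Γ → Acc _<_ (size Γ) → Transversal Γ
  hall-acc Γ hallΓ (acc smaller) with all? (λ x → ∣ Γ x ∣ ≤? 1)
  ... | yes ∣Γ∣≤1 = hall-∣Γ∣≤1 Γ hallΓ ∣Γ∣≤1
  ... | no ¬∣Γ∣≤1 with ¬∀⟶∃¬ _ _ (λ x → ∣ Γ x ∣ ≤? 1) ¬∣Γ∣≤1
  ...   | x , ∣Γx∣≰1 with 1<∣p∣⇒∃-distinct (≰⇒> ∣Γx∣≰1)
  ...     | y₁ , y₂ , y₁∈Γx , y₂∈Γx , y₁≢y₂ with hallCondition-delete Γ x hallΓ y₁≢y₂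
  ...       | inj₁ hall₁ =
    transversal-delete Γ x y₁ (hall-acc _ hall₁ (smaller (size-delete Γ y₁∈Γx)))
  ...       | inj₂ hall₂ =
    transversal-delete Γ x y₂ (hall-acc _ hall₂ (smaller (size-delete Γ y₂∈Γx)))

∈-tabulate⁺ : ∀ {p : Fin n → Bool} {i} → p i ≡ true → i ∈ tabulate p
∈-tabulate⁺ {p = p} {i} pi≡true = lookup⇒[]= i (tabulate p) (trans (lookup∘tabulate p i) pi≡true)

∈-tabulate⁻ : ∀ {p : Fin n → Bool} {i} → i ∈ tabulate p → p i ≡ true
∈-tabulate⁻ {p = p} {i} i∈p = trans (sym (lookup∘tabulate p i)) ([]=⇒lookup i∈p)

countFin≡∣tabulate∣ : (p : Fin n → Bool) → countFin p ≡ ∣ tabulate p ∣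
countFin≡∣tabulate∣ {zero}  p = refl
countFin≡∣tabulate∣ {suc n} p with p zero
... | true  = cong suc (countFin≡∣tabulate∣ (p ∘ suc))
... | false = countFin≡∣tabulate∣ (p ∘ suc)

countFin-mono : ∀ {p q : Fin n → Bool} → (∀ {i} → p i ≡ true → q i ≡ true) → countFin p ≤ countFin q
countFin-mono {p = p} {q} p⇒q = begin
  countFin p       ≡⟨ countFin≡∣tabulate∣ p ⟩
  ∣ tabulate p ∣   ≤⟨ p⊆q⇒∣p∣≤∣q∣ tabulate-p⊆tabulate-q ⟩
  ∣ tabulate q ∣   ≡⟨ countFin≡∣tabulate∣ q ⟨
  countFin q       ∎
  where
  open ≤-Reasoning
  tabulate-p⊆tabulate-q : tabulate p ⊆ tabulate q
  tabulate-p⊆tabulate-q = ∈-tabulate⁺ {p = q} ∘ p⇒q ∘ ∈-tabulate⁻ {p = p}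

degA≤countFin-∧ : ∀ (G : BipGraph m n) x (Y : Subset n) → (∀ {y} → G x y ≡ true → y ∈ Y) →
                  degA G x ≤ countFin (λ y → lookup Y y ∧ G x y)
degA≤countFin-∧ G x Y N⊆Y = countFin-mono {p = G x} λ {y} Gxy →
  subst (λ b → b ∧ G x y ≡ true) (sym ([]=⇒lookup (N⊆Y Gxy))) Gxy

δ*∣X∣≤eG : ∀ (G : BipGraph m n) X Y {δ} →
           (∀ {x} → x ∈ X → δ ≤ countFin (λ y → lookup Y y ∧ G x y)) → δ * ∣ X ∣ ≤ eG G X Y
δ*∣X∣≤eG G []            Y {δ} _ = ≤-reflexive (*-zeroʳ δ)
δ*∣X∣≤eG G (inside  ∷ X) Y {δ} δ≤ = begin
  δ * suc ∣ X ∣           ≡⟨ *-suc δ ∣ X ∣ ⟩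
  δ + δ * ∣ X ∣           ≤⟨ +-mono-≤ (δ≤ here) (δ*∣X∣≤eG (G ∘ suc) X Y (δ≤ ∘ there)) ⟩
  eG G (inside ∷ X) Y     ∎
  where open ≤-Reasoning
δ*∣X∣≤eG G (outside ∷ X) Y     δ≤ = δ*∣X∣≤eG (G ∘ suc) X Y (δ≤ ∘ there)

adjacency : BipGraph m n → Fin m → Subset n
adjacency G x = tabulate (G x)

matching-of-transversal : ∀ (G : BipGraph m n) → Transversal (adjacency G) → MatchingSaturatingA G
matching-of-transversal G = Product.map₂ (Product.map₂ (∈-tabulate⁻ ∘_))

lemma4p4 : (a b : ℕ) → a ≤ b → (G : BipGraph a b) → (δ : ℕ) → .{{_ : NonZero δ}}
    → (∀ x → δ ≤ degA G x)
    → (∀ (X : Subset a) (Y : Subset b) → Nonempty X → ∣ X ∣ ≡ ∣ Y ∣ → eG G X Y < δ * ∣ X ∣)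
    → MatchingSaturatingA G
lemma4p4 a b a≤b G δ δ≤deg e<δ∣X∣ = matching-of-transversal G (hall Γ hallΓ)
  where
  Γ = adjacency G
  hallΓ : HallCondition Γ
  hallΓ X with ∣ X ∣ ≤? ∣ neighbours Γ X ∣
  ... | yes ∣X∣≤∣N∣ = ∣X∣≤∣N∣
  ... | no  ∣X∣≰∣N∣
    with enlarge (neighbours Γ X) (<⇒≤ (≰⇒> ∣X∣≰∣N∣)) (≤-trans (∣p∣≤n X) a≤b)
  ...   | Y , N⊆Y , ∣Y∣≡∣X∣ = contradiction (e<δ∣X∣ X Y X≠∅ (sym ∣Y∣≡∣X∣)) (≤⇒≯ δ∣X∣≤e)
    where
    X≠∅ = 0<∣p∣⇒Nonempty (≤-<-trans z≤n (≰⇒> ∣X∣≰∣N∣))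
    δ∣X∣≤e = δ*∣X∣≤eG G X Y λ {x} x∈X → ≤-trans (δ≤deg x)
      (degA≤countFin-∧ G x Y (N⊆Y ∘ ∈-neighbours⁺ Γ x∈X ∘ ∈-tabulate⁺))
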